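{- If $G$ and $H$ are two infinite graphs, then $\beta(G\Box H)=\infty$.
   Context: All graphs are simple, connected and locally finite. The cartesian product $G\Box H$ has vertex set $V(G)\times V(H)$, with $(a,v)$ adjacent to $(b,w)$ iff either $a=b$ and $vw\in E(H)$, or $v=w$ and $ab\in E(G)$. $d$ is the shortest-path distance. A vertex $x$ resolves $u,v$ if $d(u,x)\neq d(v,x)$; a set $S$ is a resolving set if every pair of distinct vertices is resolved by some vertex of $S$. $\beta$ denotes the metric dimension: the minimum cardinality of a resolving set if a finite resolving set exists, and $\infty$ otherwise. -}

module Defs where

open import Data.Nat using (ℕ; zero; suc; _≤_)
open import Data.Product using (Σ; ∃; _×_; _,_)
open import Data.Sum using (_⊎_; inj₁; inj₂)
open import Data.List using (List)
open import Data.List.Membership.Propositional using (_∈_)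
open import Data.List.Relation.Unary.Any using (Any)
open import Relation.Nullary using (¬_)
open import Relation.Binary.PropositionalEquality using (_≡_; _≢_; refl; sym)

record Graph : Set₁ where
  field
    V     : Set
    _~_   : V → V → Set
    ~-sym : ∀ {u v} → u ~ v → v ~ u
    ~-irr : ∀ {u} → ¬ (u ~ u)

module _ (G : Graph) where
  open Graph G

  data Walk : V → V → ℕ → Set where
    here : ∀ {u} → Walk u u zero
    step : ∀ {u w v n} → u ~ w → Walk w v n → Walk u v (suc n)

  Dist : V → V → ℕ → Set
  Dist u v n = Walk u v n × (∀ m → Walk u v m → n ≤ m)

  Connected : Set
  Connected = ∀ u v → ∃ λ n → Walk u v n

  LocallyFinite : Set
  LocallyFinite = ∀ v → Σ (List V) λ ns → ∀ w → v ~ w → w ∈ ns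

  Infinite : Set
  Infinite = ¬ (Σ (List V) λ xs → ∀ v → v ∈ xs)

  Resolves : V → V → V → Set
  Resolves x u v = ¬ (∃ λ n → Dist u x n × Dist v x n)

  IsResolving : List V → Set
  IsResolving S = ∀ u v → u ≢ v → Any (λ x → Resolves x u v) S

  MetricDimInfinite : Set
  MetricDimInfinite = ∀ (S : List V) → ¬ IsResolving S

_□_ : Graph → Graph → Graph
G □ H = record
  { V = G.V × H.V
  ; _~_ = adj
  ; ~-sym = adj-sym
  ; ~-irr = adj-irr
  }
  where
    module G = Graph G
    module H = Graph H
    adj : G.V × H.V → G.V × H.V → Set
    adj (a , v) (b , w) = (a ≡ b × H._~_ v w) ⊎ (v ≡ w × G._~_ a b)
    adj-sym : ∀ {p q} → adj p q → adj q p
    adj-sym (inj₁ (e , x)) = inj₁ (sym e , H.~-sym x)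
    adj-sym (inj₂ (e , x)) = inj₂ (sym e , G.~-sym x)
    adj-irr : ∀ {p} → ¬ adj p p
    adj-irr (inj₁ (_ , x)) = H.~-irr x
    adj-irr (inj₂ (_ , x)) = G.~-irr x

module Submission where

-- Key fact (for one graph G): for every finite A ⊆ V(G) there is an edge
-- xy with d(y,a) = d(x,a) + 1 for all a ∈ A.  Otherwise the potential
-- Φ(v) = Σ_{a∈A} d(v,a), which grows by at most |A| along an edge, grows
-- by at most |A| - 1 along every edge; on a geodesic from a fixed c to v
-- this gives Φ(v) + d(c,v) ≤ Φ(c) + d(c,v)·|A|, while the triangle
-- inequality gives d(c,v)·|A| ≤ Φ(v) + Φ(c).  So every vertex lies in
-- the ball of radius 2Φ(c) about c, which is finite by local finiteness.
--
-- Applying the key fact to the projections of S in G and in H yields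
-- edges x₁y₁ and x₂y₂; since distances add in G □ H, the distinct
-- vertices (y₁,x₂) and (x₁,y₂) are at equal distance from every s ∈ S.
--
-- Distances exist only up to double negation (adjacency is not
-- decidable), so the argument runs in the double-negation monad; this is
-- harmless because the conclusion is itself a negation.

open import Defs
open import Level using (0ℓ)
open import Data.Nat
open import Data.Nat.Properties
open import Data.Nat.Induction using (<-rec)
open import Data.Nat.ListAction using (sum)
open import Data.Nat.Tactic.RingSolver using (solve-∀)
open import Data.Product using (∃; ∃₂; _×_; _,_; proj₁; proj₂)
open import Data.Sum using (inj₁; inj₂)
open import Data.List using (List; []; _∷_; _++_; concatMap; map; length)
open import Data.List.Membership.Propositional using (_∈_)
open import Data.List.Membership.Propositional.Properties using (∈-++⁺ˡ; ∈-++⁺ʳ; ∈-concatMap⁺)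
open import Data.List.Relation.Unary.Any as Any using (here)
open import Data.List.Relation.Unary.All as All using (All)
open import Data.List.Relation.Unary.All.Properties using (map⁻; Any¬⇒¬All)
open import Data.List.Relation.Binary.Pointwise using (Pointwise; []; _∷_)
open import Data.Empty using (⊥-elim)
open import Effect.Monad using (RawMonad)
open import Relation.Nullary using (¬_)
open import Relation.Nullary.Negation using (¬¬-Monad)
open import Relation.Binary.PropositionalEquality

open RawMonad (¬¬-Monad {a = 0ℓ}) using (return; _>>=_)

shift-suc : ∀ d s l → suc d + (s + l) ≡ (d + s) + suc l
shift-suc = solve-∀

interchange : ∀ a b c d → (a + b) + (c + d) ≡ (a + c) + (b + d)
interchange = solve-∀

sum-tight : ∀ {a b c d} → a ≤ b → c ≤ d → b + d ≤ a + c → a ≡ b × c ≡ d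
sum-tight {a} {b} {c} {d} a≤b c≤d b+d≤a+c =
    ≤-antisym a≤b (+-cancelʳ-≤ d b a (≤-trans b+d≤a+c (+-monoʳ-≤ a c≤d)))
  , ≤-antisym c≤d (+-cancelˡ-≤ b d c (≤-trans b+d≤a+c (+-monoˡ-≤ c a≤b)))

-- The two estimates on Φ(v) in the key fact confine d(c,v) = M to 2Φ(c).
radius-bound : ∀ {M l φc φv} → φv + M ≤ φc + M * l → M * l ≤ φv + φc → M ≤ φc + φc
radius-bound {M} {l} {φc} {φv} upper lower = +-cancelˡ-≤ φv M (φc + φc) (begin
  φv + M              ≤⟨ upper ⟩
  φc + M * l          ≤⟨ +-monoʳ-≤ φc lower ⟩
  φc + (φv + φc)      ≡⟨ regroup φc φv ⟩
  φv + (φc + φc)      ∎)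
  where
  open ≤-Reasoning
  regroup : ∀ a b → a + (b + a) ≡ b + (a + a)
  regroup = solve-∀

module Distances (G : Graph) where
  open Graph G

  _++ʷ_ : ∀ {u v w m n} → Walk G u v m → Walk G v w n → Walk G u w (m + n)
  here     ++ʷ q = q
  step h p ++ʷ q = step h (p ++ʷ q)

  reverseʷ : ∀ {u v n} → Walk G u v n → Walk G v u n
  reverseʷ here               = here
  reverseʷ (step {n = n} h p) =
    subst (Walk G _ _) (+-comm n 1) (reverseʷ p ++ʷ step (~-sym h) here)

  -- Any walk from u to v yields (double-negated) a shortest one: a walk
  -- that is not shortest has a strictly shorter one, so by well-founded
  -- induction on the length the absence of a distance is absurd.
  distance-exists : ∀ {u v n} → Walk G u v n → ¬ ¬ (∃ λ d → Dist G u v d)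
  distance-exists {u} {v} {n} w no-distance = <-rec (λ m → ¬ Walk G u v m) shortest n w
    where
    shortest : ∀ m → (∀ {m'} → m' < m → ¬ Walk G u v m') → ¬ Walk G u v m
    shortest m no-shorter w = no-distance (m , w , λ m' w' → ≮⇒≥ (λ m'<m → no-shorter m'<m w'))

  triangle : ∀ {u v a M d e} → Dist G u v M → Dist G u a d → Dist G v a e → M ≤ d + e
  triangle (_ , minimal) (ua , _) (va , _) = minimal _ (ua ++ʷ reverseʷ va)

  lipschitz : ∀ {x y a d e} → x ~ y → Dist G x a d → Dist G y a e → e ≤ suc d
  lipschitz x~y (xa , _) (_ , minimal) = minimal _ (step (~-sym x~y) xa)

  Profile : V → List V → List ℕ → Set
  Profile x = Pointwise (Dist G x)

  profile-exists : Connected G → ∀ x A → ¬ ¬ (∃ λ ds → Profile x A ds)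
  profile-exists C x []      = return ([] , [])
  profile-exists C x (a ∷ A) = do
    (d , D)   ← distance-exists (proj₂ (C x a))
    (ds , Ds) ← profile-exists C x A
    return (d ∷ ds , D ∷ Ds)

  FartherFrom : List V → V → V → Set
  FartherFrom A x y = All (λ a → ∃ λ d → Dist G x a d × Dist G y a (suc d)) A

  potential-step : ∀ {x y A ds es} → x ~ y → Profile x A ds → Profile y A es
                 → sum es ≤ sum ds + length A
  potential-step x~y [] [] = z≤n
  potential-step {A = _ ∷ A} {d ∷ ds} x~y (Dx ∷ Px) (Dy ∷ Py) =
    ≤-trans (+-mono-≤ (lipschitz x~y Dx Dy) (potential-step x~y Px Py))
            (≤-reflexive (shift-suc d (sum ds) (length A)))

  potential-tight : ∀ {x y A ds es} → x ~ y → Profile x A ds → Profile y A es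
                  → sum ds + length A ≤ sum es → FartherFrom A x y
  potential-tight x~y [] [] _ = All.[]
  potential-tight {A = _ ∷ A} {d ∷ ds} {e ∷ es} x~y (Dx ∷ Px) (Dy ∷ Py) tight
    with sum-tight (lipschitz x~y Dx Dy) (potential-step x~y Px Py)
                   (subst (_≤ e + sum es) (sym (shift-suc d (sum ds) (length A))) tight)
  ... | e≡1+d , rest≡ =
    (d , Dx , subst (Dist G _ _) e≡1+d Dy) All.∷ potential-tight x~y Px Py (≤-reflexive (sym rest≡))

  NoFartherEdge : List V → Set
  NoFartherEdge A = ¬ (∃₂ λ x y → x ~ y × FartherFrom A x y)

  potential-strict : ∀ {x y A ds es} → NoFartherEdge A → x ~ y
                   → Profile x A ds → Profile y A es → sum es < sum ds + length A
  potential-strict {x} {y} none x~y Px Py with m≤n⇒m<n∨m≡n (potential-step x~y Px Py)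
  ... | inj₁ strict = strict
  ... | inj₂ exact  = ⊥-elim (none (x , y , x~y , potential-tight x~y Px Py (≤-reflexive (sym exact))))

  walk-bound : ∀ {A} → Connected G → NoFartherEdge A
             → ∀ {x v n ds} → Walk G x v n → Profile x A ds
             → ¬ ¬ (∃ λ es → Profile v A es × sum es + n ≤ sum ds + n * length A)
  walk-bound C none {ds = ds} here Px = return (ds , Px , ≤-refl)
  walk-bound {A} C none {n = suc n} {ds} (step {w = y} x~y w) Px = do
    (_ , Py)          ← profile-exists C y A
    (es , Pv , bound) ← walk-bound C none w Py
    return (es , Pv , extend (potential-strict none x~y Px Py) bound)
    where
    open ≤-Reasoning
    extend : ∀ {f e} → suc f ≤ sum ds + length A → e + n ≤ f + n * length A
           → e + suc n ≤ sum ds + suc n * length A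
    extend {f} {e} step-bound rest-bound = begin
      e + suc n                       ≡⟨ +-suc e n ⟩
      suc (e + n)                     ≤⟨ s≤s rest-bound ⟩
      suc f + n * length A            ≤⟨ +-monoˡ-≤ (n * length A) step-bound ⟩
      sum ds + length A + n * length A ≡⟨ +-assoc (sum ds) (length A) (n * length A) ⟩
      sum ds + suc n * length A       ∎

  triangle-sum : ∀ {c v M A ds es} → Dist G c v M → Profile c A ds → Profile v A es
               → M * length A ≤ sum es + sum ds
  triangle-sum {M = M} D [] [] = ≤-reflexive (*-zeroʳ M)
  triangle-sum {M = M} {_ ∷ A} {d ∷ ds} {e ∷ es} D (Dc ∷ Pc) (Dv ∷ Pv) = begin
    M * suc (length A)               ≡⟨ *-suc M (length A) ⟩
    M + M * length A                 ≤⟨ +-mono-≤ (triangle D Dc Dv) (triangle-sum D Pc Pv) ⟩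
    (d + e) + (sum es + sum ds)      ≡⟨ cong (_+ (sum es + sum ds)) (+-comm d e) ⟩
    (e + d) + (sum es + sum ds)      ≡⟨ interchange e d (sum es) (sum ds) ⟩
    (e + sum es) + (d + sum ds)      ∎
    where open ≤-Reasoning

module Balls (G : Graph) (LF : LocallyFinite G) where
  open Graph G

  neighbours : V → List V
  neighbours v = proj₁ (LF v)

  grow : List V → List V
  grow xs = xs ++ concatMap neighbours xs

  ball : V → ℕ → List V
  ball c zero    = c ∷ []
  ball c (suc n) = grow (ball c n)

  grow-keeps : ∀ {x xs} → x ∈ xs → x ∈ grow xs
  grow-keeps = ∈-++⁺ˡ

  grow-adds : ∀ {u w xs} → u ∈ xs → u ~ w → w ∈ grow xs
  grow-adds {u} {w} {xs} u∈xs u~w =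
    ∈-++⁺ʳ xs (∈-concatMap⁺ neighbours (Any.map (λ { refl → proj₂ (LF u) w u~w }) u∈xs))

  ball-mono : ∀ {c x m n} → m ≤ n → x ∈ ball c m → x ∈ ball c n
  ball-mono {n = zero} z≤n x∈ = x∈
  ball-mono {m = m} {suc n} m≤1+n x∈ with m≤n⇒m<n∨m≡n m≤1+n
  ... | inj₁ (s≤s m≤n) = grow-keeps (ball-mono m≤n x∈)
  ... | inj₂ refl      = x∈

  walk-in-ball : ∀ {c u v k m} → u ∈ ball c k → Walk G u v m → v ∈ ball c (m + k)
  walk-in-ball u∈ here = u∈
  walk-in-ball {c} {v = v} {k} u∈ (step {n = m} u~w w) =
    subst (λ r → v ∈ ball c r) (+-suc m k) (walk-in-ball (grow-adds u∈ u~w) w)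

  stable-ball : ∀ {c R u v m} → (∀ {x} → x ∈ ball c (suc R) → x ∈ ball c R)
              → u ∈ ball c R → Walk G u v m → v ∈ ball c R
  stable-ball stable u∈ here = u∈
  stable-ball {c} {R} stable u∈ (step u~w w) = stable-ball {c} {R} stable (stable (grow-adds u∈ u~w)) w

  ball-escape : Connected G → Infinite G → ∀ c R → ¬ (∀ v → ¬ ¬ (v ∈ ball c R))
  ball-escape C inf c R near =
    All.sequenceM 0ℓ ¬¬-Monad (All.tabulate (λ {x} _ → near x)) λ stable →
      inf (ball c R , λ v → stable-ball {c} {R} (All.lookup stable)
                                          (ball-mono {c} {n = R} z≤n (here refl)) (proj₂ (C c v)))

some-vertex : (G : Graph) → Infinite G → ¬ ¬ Graph.V G
some-vertex G inf no-vertex = inf ([] , λ v → ⊥-elim (no-vertex v))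

farther-edge-exists : (G : Graph) → Connected G → LocallyFinite G → Infinite G
                    → ∀ A → ¬ ¬ (∃₂ λ x y → Graph._~_ G x y × Distances.FartherFrom G A x y)
farther-edge-exists G C LF inf A none =
  some-vertex G inf λ c → profile-exists C c A λ (ds , Pc) →
    ball-escape C inf c (sum ds + sum ds) (within-radius Pc)
  where
  open Distances G
  open Balls G LF
  within-radius : ∀ {c ds} → Profile c A ds → ∀ v → ¬ ¬ (v ∈ ball c (sum ds + sum ds))
  within-radius {c} Pc v = do
    (M , DM)          ← distance-exists (proj₂ (C c v))
    (es , Pv , upper) ← walk-bound C none (proj₁ DM) Pc
    return (ball-mono {c} (radius-bound {M} {length A} upper (triangle-sum DM Pc Pv))
                      (subst (λ r → v ∈ ball c r) (+-identityʳ M) (walk-in-ball (here refl) (proj₁ DM))))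

module Product (G H : Graph) where
  open Distances (G □ H) using (_++ʷ_)

  liftG : ∀ {a b v n} → Walk G a b n → Walk (G □ H) (a , v) (b , v) n
  liftG here       = here
  liftG (step h w) = step (inj₂ (refl , h)) (liftG w)

  liftH : ∀ {a v w n} → Walk H v w n → Walk (G □ H) (a , v) (a , w) n
  liftH here       = here
  liftH (step h w) = step (inj₁ (refl , h)) (liftH w)

  split : ∀ {a v b w m} → Walk (G □ H) (a , v) (b , w) m
        → ∃₂ λ p q → Walk G a b p × Walk H v w q × p + q ≡ m
  split here = 0 , 0 , here , here , refl
  split (step (inj₁ (refl , h)) r) with split r
  ... | p , q , wG , wH , p+q≡ = p , suc q , wG , step h wH , trans (+-suc p q) (cong suc p+q≡)
  split (step (inj₂ (refl , h)) r) with split r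
  ... | p , q , wG , wH , p+q≡ = suc p , q , step h wG , wH , cong suc p+q≡

  product-distance : ∀ {a b v w p q} → Dist G a b p → Dist H v w q → Dist (G □ H) (a , v) (b , w) (p + q)
  product-distance (wG , minG) (wH , minH) = liftG wG ++ʷ liftH wH , λ m r → shortest (split r)
    where
    shortest : ∀ {m} → (∃₂ λ p' q' → Walk G _ _ p' × Walk H _ _ q' × p' + q' ≡ m) → _ ≤ m
    shortest (p' , q' , wG' , wH' , refl) = +-mono-≤ (minG p' wG') (minH q' wH')

  equidistant : ∀ {x₁ y₁ a x₂ y₂ b}
              → (∃ λ p → Dist G x₁ a p × Dist G y₁ a (suc p))
              → (∃ λ q → Dist H x₂ b q × Dist H y₂ b (suc q))
              → ∃ λ n → Dist (G □ H) (y₁ , x₂) (a , b) n × Dist (G □ H) (x₁ , y₂) (a , b) n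
  equidistant (p , Dx₁ , Dy₁) (q , Dx₂ , Dy₂) =
    suc p + q , product-distance Dy₁ Dx₂ , subst (Dist (G □ H) _ _) (+-suc p q) (product-distance Dx₁ Dy₂)

corollary2 : (G H : Graph)
    → Connected G → LocallyFinite G → Infinite G
    → Connected H → LocallyFinite H → Infinite H
    → MetricDimInfinite (G □ H)
corollary2 G H CG LG IG CH LH IH S resolving =
  farther-edge-exists G CG LG IG (map proj₁ S) λ (x₁ , y₁ , x₁~y₁ , far₁) →
  farther-edge-exists H CH LH IH (map proj₂ S) λ (x₂ , y₂ , _ , far₂) →
  Any¬⇒¬All (resolving (y₁ , x₂) (x₁ , y₂) (distinct x₁~y₁))
            (All.zipWith (λ (f₁ , f₂) → equidistant f₁ f₂) (map⁻ far₁ , map⁻ far₂))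
  where
  open Product G H
  distinct : ∀ {x₁ y₁ x₂ y₂} → Graph._~_ G x₁ y₁ → (y₁ , x₂) ≢ (x₁ , y₂)
  distinct x₁~y₁ eq = Graph.~-irr G (subst (Graph._~_ G _) (cong proj₁ eq) x₁~y₁)
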